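{- For odd $n\ge3$ let $g_n:\{ -1,1\}^n\to\{ -1,1\}$ be $g_n(x_1,\dots,x_n)=\mathrm{sgn}\big(2(x_1+\cdots+x_{n-3})+x_{n-2}+x_{n-1}+x_n\big)$. Then $W^{(0)}[g_n]=0$ and $$W^{(1)}[g_n]=(n-3)\Big[\frac{8\binom{n-4}{(n-5)/2}}{2^{n-1}}\Big]^2+3\Big[\frac{2\binom{n-3}{(n-3)/2}}{2^{n-1}}\Big]^2.$$
   Context: $\mathrm{sgn}(z)=1$ if $z\ge0$ and $-1$ if $z<0$. The Fourier coefficients of $f:\{ -1,1\}^n\to\{ -1,1\}$ are $\hat f(S)=2^{ -n}\sum_{\mathbf{x}\in\{ -1,1\}^n} f(\mathbf{x})\prod_{i\in S}x_i$ for $S\subseteq[n]$, and $W^{(k)}[f]=\sum_{S\subseteq[n],|S|=k}\hat f(S)^2$. -}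

module Defs where

open import Data.Nat as ℕ using (ℕ; zero; suc; _^_; _∸_; _<ᵇ_)
open import Data.Nat.Properties using (m^n≢0)
open import Data.Bool using (Bool; true; false; if_then_else_)
open import Data.Integer as ℤ using (ℤ; +_; -[1+_])
open import Data.Rational as ℚ using (ℚ)
open import Data.Sign using (Sign)
open import Data.Fin using (Fin; toℕ)
open import Data.Fin.Subset using (Subset; Side; inside; outside; ∣_∣)
open import Data.Vec using (Vec; []; _∷_; lookup; zipWith)
open import Data.List using (List; []; _∷_; map; foldr; concatMap; filterᵇ)

-- The Boolean cube {-1,1}^n : vectors of signs (Sign.+ ↦ 1, Sign.- ↦ -1).
Cube : ℕ → Set
Cube n = Vec Sign n

⟦_⟧ : Sign → ℤ
⟦ Sign.+ ⟧ = + 1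
⟦ Sign.- ⟧ = -[1+ 0 ]

sgn : ℤ → Sign
sgn (+ _) = Sign.+
sgn -[1+ _ ] = Sign.-

allVecs : {A : Set} → List A → (n : ℕ) → List (Vec A n)
allVecs xs zero = [] ∷ []
allVecs xs (suc n) = concatMap (λ x → map (x ∷_) (allVecs xs n)) xs

allPoints : (n : ℕ) → List (Cube n)
allPoints = allVecs (Sign.+ ∷ Sign.- ∷ [])

allSubsets : (n : ℕ) → List (Subset n)
allSubsets = allVecs (inside ∷ outside ∷ [])

sumℤ : List ℤ → ℤ
sumℤ = foldr ℤ._+_ (+ 0)

sumℚ : List ℚ → ℚ
sumℚ = foldr ℚ._+_ ℚ.0ℚ

χ : {n : ℕ} → Subset n → Cube n → ℤ
χ [] [] = + 1
χ (inside ∷ S) (s ∷ x) = ⟦ s ⟧ ℤ.* χ S x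
χ (outside ∷ S) (s ∷ x) = χ S x

fourier : {n : ℕ} → (Cube n → Sign) → Subset n → ℚ
fourier {n} f S =
  ℚ._/_ (sumℤ (map (λ x → ⟦ f x ⟧ ℤ.* χ S x) (allPoints n))) (2 ^ n) {{m^n≢0 2 n}}

W : {n : ℕ} → ℕ → (Cube n → Sign) → ℚ
W {n} k f =
  sumℚ (map (λ S → fourier f S ℚ.* fourier f S)
            (filterᵇ (λ S → ∣ S ∣ ℕ.≡ᵇ k) (allSubsets n)))

-- Weight of coordinate i (0-based): 2 for the first n-3 coordinates, 1 for the last three.
weight : {n : ℕ} → Fin n → ℤ
weight {n} i = if toℕ i <ᵇ (n ∸ 3) then + 2 else + 1

weightVec : (n : ℕ) → Vec ℤ n
weightVec n = Data.Vec.tabulate (weight {n})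

g : (n : ℕ) → Cube n → Sign
g n x = sgn (Data.Vec.foldr _ ℤ._+_ (+ 0) (zipWith (λ w s → w ℤ.* ⟦ s ⟧) (weightVec n) x))

-- Write n = 3 + 2k and let j(x) be the number of −1's among the first 2k coordinates of x.
-- The weighted sum is 4(k − j) + x_{n-2} + x_{n-1} + x_n, so g_n(x) is 1 when j < k, −1 when
-- j > k, and the majority of the last three coordinates when j = k.  Grouping the points of the
-- cube by j turns every Fourier coefficient into a binomial sum Σ_j C(·, j) T(j).  For S = ∅,
-- T(j) = 8 sgn(k − j) is antisymmetric about k, so the sum vanishes.  For S = {i} with i among the
-- first 2k coordinates, splitting on x_i leaves Σ_j C(2k − 1, j) (T(j) − T(j + 1)), whose only
-- nonzero terms are j = k − 1 and j = k.  For S inside the last three coordinates only j = k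
-- survives, where the majority function has correlation 4 with each coordinate.

module Submission where

open import Defs
open import Data.Nat as ℕ using (ℕ; zero; suc; _≤_; _<_; _∸_; _^_; _%_; _/_; z≤n; s≤s; NonZero)
open import Data.Nat.Combinatorics using (_C_; nCk+nC[k+1]≡[n+1]C[k+1]; k>n⇒nCk≡0; nCk≡nC[n∸k])
open import Data.Nat.Properties using (m^n≢0)
import Data.Nat.Properties as NP
import Data.Nat.DivMod as DM
import Data.Nat.Tactic.RingSolver as ℕ-Solver
open import Data.Integer as ℤ using (ℤ; +_; -[1+_]; _⊖_)
import Data.Integer.Properties as ZP
open import Algebra.Properties.CommutativeSemigroup ZP.+-commutativeSemigroup using (interchange)
open import Data.Rational as ℚ using (ℚ; 0ℚ; 1ℚ; mkℚ; _+_; _*_)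
import Data.Rational.Properties as QP
open import Data.Rational.Unnormalised using (mkℚᵘ; *≡*)
import Data.Nat.Coprimality as Coprimality
open import Data.Sign as Sign using (Sign)
open import Data.Fin using (zero)
open import Data.Fin.Subset using (Subset; inside; outside; ∣_∣; ⊥; ⁅_⁆)
open import Data.Bool using (Bool; true; false)
open import Data.Vec as V using (_∷_; []; zipWith)
import Data.Vec.Properties as VP
open import Data.List using (List; []; _∷_; map; _++_; filterᵇ; length)
import Data.List.Properties as LP
open import Data.List.Relation.Unary.All as All using (All; []; _∷_)
import Data.List.Relation.Unary.All.Properties as AllP
open import Data.Product using (_×_; _,_; ∃-syntax)
open import Function using (_∘_)
open import Relation.Binary.Definitions using (tri<; tri≈; tri>)
open import Relation.Nullary.Decidable using (T?)
open import Relation.Binary.PropositionalEquality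

sumℤ-++ : ∀ xs ys → sumℤ (xs ++ ys) ≡ sumℤ xs ℤ.+ sumℤ ys
sumℤ-++ []       ys = sym (ZP.+-identityˡ _)
sumℤ-++ (x ∷ xs) ys = trans (cong (ℤ._+_ x) (sumℤ-++ xs ys)) (sym (ZP.+-assoc x _ _))

sumℤ-neg : ∀ xs → sumℤ (map ℤ.-_ xs) ≡ ℤ.- sumℤ xs
sumℤ-neg []       = refl
sumℤ-neg (x ∷ xs) = trans (cong (ℤ._+_ (ℤ.- x)) (sumℤ-neg xs)) (sym (ZP.neg-distrib-+ x _))

sumℤ-*ˡ : ∀ c xs → sumℤ (map (c ℤ.*_) xs) ≡ c ℤ.* sumℤ xs
sumℤ-*ˡ c []       = sym (ZP.*-zeroʳ c)
sumℤ-*ˡ c (x ∷ xs) = trans (cong (ℤ._+_ (c ℤ.* x)) (sumℤ-*ˡ c xs)) (sym (ZP.*-distribˡ-+ c x _))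

sumCube : (n : ℕ) → (Cube n → ℤ) → ℤ
sumCube n h = sumℤ (map h (allPoints n))

sumCube-cong : ∀ n {h h′ : Cube n → ℤ} → (∀ x → h x ≡ h′ x) → sumCube n h ≡ sumCube n h′
sumCube-cong n h≗h′ = cong sumℤ (LP.map-cong h≗h′ (allPoints n))

sumCube-neg : ∀ n (h : Cube n → ℤ) → sumCube n (λ x → ℤ.- h x) ≡ ℤ.- sumCube n h
sumCube-neg n h = trans (cong sumℤ (LP.map-∘ (allPoints n))) (sumℤ-neg (map h (allPoints n)))

sumCube-*ˡ : ∀ n c (h : Cube n → ℤ) → sumCube n (λ x → c ℤ.* h x) ≡ c ℤ.* sumCube n h
sumCube-*ˡ n c h = trans (cong sumℤ (LP.map-∘ (allPoints n))) (sumℤ-*ˡ c (map h (allPoints n)))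

sumCube-suc : ∀ n (h : Cube (suc n) → ℤ) →
  sumCube (suc n) h ≡ sumCube n (λ x → h (Sign.+ ∷ x)) ℤ.+ sumCube n (λ x → h (Sign.- ∷ x))
sumCube-suc n h = begin
  sumℤ (map h (pos ++ (neg ++ [])))            ≡⟨ cong (λ ys → sumℤ (map h (pos ++ ys))) (LP.++-identityʳ neg) ⟩
  sumℤ (map h (pos ++ neg))                    ≡⟨ cong sumℤ (LP.map-++ h pos neg) ⟩
  sumℤ (map h pos ++ map h neg)                ≡⟨ sumℤ-++ (map h pos) (map h neg) ⟩
  sumℤ (map h pos) ℤ.+ sumℤ (map h neg)        ≡⟨ cong₂ ℤ._+_ (cong sumℤ (LP.map-∘ xs)) (cong sumℤ (LP.map-∘ xs)) ⟨
  sumCube n (λ x → h (Sign.+ ∷ x)) ℤ.+ sumCube n (λ x → h (Sign.- ∷ x)) ∎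
  where
  open ≡-Reasoning
  xs  = allPoints n
  pos = map (Sign.+ ∷_) xs
  neg = map (Sign.- ∷_) xs

sumBelow : ℕ → (ℕ → ℤ) → ℤ
sumBelow zero    f = + 0
sumBelow (suc n) f = f 0 ℤ.+ sumBelow n (f ∘ suc)

sumBelow-cong : ∀ n {f h : ℕ → ℤ} → (∀ j → j < n → f j ≡ h j) → sumBelow n f ≡ sumBelow n h
sumBelow-cong zero    f≗h = refl
sumBelow-cong (suc n) f≗h = cong₂ ℤ._+_ (f≗h 0 ℕ.z<s) (sumBelow-cong n (λ j j<n → f≗h (suc j) (s≤s j<n)))

sumBelow-+ : ∀ n f h → sumBelow n f ℤ.+ sumBelow n h ≡ sumBelow n (λ j → f j ℤ.+ h j)
sumBelow-+ zero    f h = refl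
sumBelow-+ (suc n) f h =
  trans (interchange (f 0) _ (h 0) _) (cong (ℤ._+_ (f 0 ℤ.+ h 0)) (sumBelow-+ n (f ∘ suc) (h ∘ suc)))

sumBelow-neg : ∀ n f → sumBelow n (λ j → ℤ.- f j) ≡ ℤ.- sumBelow n f
sumBelow-neg zero    f = refl
sumBelow-neg (suc n) f = trans (cong (ℤ._+_ (ℤ.- f 0)) (sumBelow-neg n (f ∘ suc))) (sym (ZP.neg-distrib-+ (f 0) _))

sumBelow-snoc : ∀ n f → sumBelow (suc n) f ≡ sumBelow n f ℤ.+ f n
sumBelow-snoc zero    f = ZP.+-comm (f 0) (+ 0)
sumBelow-snoc (suc n) f = trans (cong (ℤ._+_ (f 0)) (sumBelow-snoc n (f ∘ suc))) (sym (ZP.+-assoc (f 0) _ _))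

sumBelow-reverse : ∀ n f → sumBelow n f ≡ sumBelow n (λ i → f (n ∸ suc i))
sumBelow-reverse zero    f = refl
sumBelow-reverse (suc n) f = begin
  sumBelow (suc n) f                           ≡⟨ sumBelow-snoc n f ⟩
  sumBelow n f ℤ.+ f n                         ≡⟨ cong (ℤ._+ f n) (sumBelow-reverse n f) ⟩
  sumBelow n (λ i → f (n ∸ suc i)) ℤ.+ f n     ≡⟨ ZP.+-comm _ (f n) ⟩
  f n ℤ.+ sumBelow n (λ i → f (n ∸ suc i))     ∎
  where open ≡-Reasoning

sumBelow-window : ∀ {n} a ℓ (f : ℕ → ℤ) → ℓ ℕ.+ a ≤ n →
  (∀ j → j < a → f j ≡ + 0) → (∀ j → ℓ ℕ.+ a ≤ j → f j ≡ + 0) →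
  sumBelow n f ≡ sumBelow ℓ (λ i → f (i ℕ.+ a))
sumBelow-window {zero}  zero zero    f _ _ _ = refl
sumBelow-window {suc n} zero zero    f _ _ above =
  cong₂ ℤ._+_ (above 0 z≤n) (sumBelow-window {n} zero zero (f ∘ suc) z≤n (λ _ ()) (λ j _ → above (suc j) z≤n))
sumBelow-window {suc n} zero (suc ℓ) f (s≤s ℓ≤n) _ above =
  cong (ℤ._+_ (f 0)) (sumBelow-window {n} zero ℓ (f ∘ suc) ℓ≤n (λ _ ()) (λ j ℓ≤j → above (suc j) (s≤s ℓ≤j)))
sumBelow-window {n} (suc a) ℓ f bound below above with subst (_≤ n) (NP.+-suc ℓ a) bound
... | s≤s {n = n′} ℓ+a≤n = begin
  f 0 ℤ.+ sumBelow n′ (f ∘ suc)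
    ≡⟨ cong₂ ℤ._+_ (below 0 ℕ.z<s) (sumBelow-window {n′} a ℓ (f ∘ suc) ℓ+a≤n (λ j j<a → below (suc j) (s≤s j<a)) above′) ⟩
  + 0 ℤ.+ sumBelow ℓ (λ i → f (suc (i ℕ.+ a)))
    ≡⟨ ZP.+-identityˡ _ ⟩
  sumBelow ℓ (λ i → f (suc (i ℕ.+ a)))
    ≡⟨ sumBelow-cong ℓ (λ i _ → cong f (NP.+-suc i a)) ⟨
  sumBelow ℓ (λ i → f (i ℕ.+ suc a)) ∎
  where
  open ≡-Reasoning
  above′ : ∀ j → ℓ ℕ.+ a ≤ j → f (suc j) ≡ + 0
  above′ j ℓ+a≤j = above (suc j) (subst (_≤ suc j) (sym (NP.+-suc ℓ a)) (s≤s ℓ+a≤j))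

binomialSum : ℕ → (ℕ → ℤ) → ℤ
binomialSum m G = sumBelow (suc m) (λ j → + (m C j) ℤ.* G j)

binomialSum-cong : ∀ m {G H : ℕ → ℤ} → (∀ j → G j ≡ H j) → binomialSum m G ≡ binomialSum m H
binomialSum-cong m G≗H = sumBelow-cong (suc m) (λ j _ → cong (ℤ._*_ (+ (m C j))) (G≗H j))

binomialSum-+ : ∀ m G H → binomialSum m G ℤ.+ binomialSum m H ≡ binomialSum m (λ j → G j ℤ.+ H j)
binomialSum-+ m G H = trans (sumBelow-+ (suc m) (λ j → + (m C j) ℤ.* G j) (λ j → + (m C j) ℤ.* H j))
  (sumBelow-cong (suc m) (λ j _ → sym (ZP.*-distribˡ-+ (+ (m C j)) (G j) (H j))))

binomialSum-suc : ∀ m G → binomialSum m G ℤ.+ binomialSum m (G ∘ suc) ≡ binomialSum (suc m) G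
binomialSum-suc m G = begin
  (first ℤ.+ sumBelow m upper) ℤ.+ sumBelow (suc m) lower   ≡⟨ cong (λ s → (first ℤ.+ s) ℤ.+ sumBelow (suc m) lower) upper-complete ⟨
  (first ℤ.+ sumBelow (suc m) upper) ℤ.+ sumBelow (suc m) lower ≡⟨ ZP.+-assoc first _ _ ⟩
  first ℤ.+ (sumBelow (suc m) upper ℤ.+ sumBelow (suc m) lower) ≡⟨ cong (ℤ._+_ first) (sumBelow-+ (suc m) upper lower) ⟩
  first ℤ.+ sumBelow (suc m) (λ j → upper j ℤ.+ lower j)   ≡⟨ cong (ℤ._+_ first) (sumBelow-cong (suc m) (λ j _ → pascal j)) ⟩
  binomialSum (suc m) G ∎
  where
  open ≡-Reasoning
  first : ℤ
  first = + 1 ℤ.* G 0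
  upper lower : ℕ → ℤ
  upper j = + (m C suc j) ℤ.* G (suc j)
  lower j = + (m C j) ℤ.* G (suc j)
  upper-complete : sumBelow (suc m) upper ≡ sumBelow m upper
  upper-complete = begin
    sumBelow (suc m) upper          ≡⟨ sumBelow-snoc m upper ⟩
    sumBelow m upper ℤ.+ upper m    ≡⟨ cong (λ c → sumBelow m upper ℤ.+ + c ℤ.* G (suc m)) (k>n⇒nCk≡0 (NP.n<1+n m)) ⟩
    sumBelow m upper ℤ.+ + 0        ≡⟨ ZP.+-identityʳ _ ⟩
    sumBelow m upper                ∎
  pascal : ∀ j → upper j ℤ.+ lower j ≡ + (suc m C suc j) ℤ.* G (suc j)
  pascal j = begin
    upper j ℤ.+ lower j                       ≡⟨ ZP.*-distribʳ-+ (G (suc j)) (+ (m C suc j)) (+ (m C j)) ⟨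
    (+ (m C suc j) ℤ.+ + (m C j)) ℤ.* G (suc j) ≡⟨ cong (λ c → + c ℤ.* G (suc j)) (NP.+-comm (m C suc j) (m C j)) ⟩
    + (m C j ℕ.+ m C suc j) ℤ.* G (suc j)     ≡⟨ cong (λ c → + c ℤ.* G (suc j)) (nCk+nC[k+1]≡[n+1]C[k+1] m j) ⟩
    + (suc m C suc j) ℤ.* G (suc j)           ∎

≡-neg⇒≡0 : ∀ {i} → i ≡ ℤ.- i → i ≡ + 0
≡-neg⇒≡0 {+ zero}   _  = refl
≡-neg⇒≡0 {+ suc _}  ()
≡-neg⇒≡0 { -[1+ _ ]} ()

-- Reindexing j ↦ m ∸ j turns the sum into its own negative.
binomialSum-antisym : ∀ m G → (∀ j → j ≤ m → G (m ∸ j) ≡ ℤ.- G j) → binomialSum m G ≡ + 0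
binomialSum-antisym m G antisym = ≡-neg⇒≡0 (begin
  binomialSum m G                                      ≡⟨ sumBelow-reverse (suc m) (λ j → + (m C j) ℤ.* G j) ⟩
  sumBelow (suc m) (λ j → + (m C (m ∸ j)) ℤ.* G (m ∸ j))  ≡⟨ sumBelow-cong (suc m) reflect ⟩
  sumBelow (suc m) (λ j → ℤ.- (+ (m C j) ℤ.* G j))        ≡⟨ sumBelow-neg (suc m) (λ j → + (m C j) ℤ.* G j) ⟩
  ℤ.- binomialSum m G                                  ∎)
  where
  open ≡-Reasoning
  reflect : ∀ j → j < suc m → + (m C (m ∸ j)) ℤ.* G (m ∸ j) ≡ ℤ.- (+ (m C j) ℤ.* G j)
  reflect j (s≤s j≤m) = begin
    + (m C (m ∸ j)) ℤ.* G (m ∸ j)   ≡⟨ cong₂ (λ c g → + c ℤ.* g) (sym (nCk≡nC[n∸k] j≤m)) (antisym j j≤m) ⟩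
    + (m C j) ℤ.* ℤ.- G j           ≡⟨ ZP.neg-distribʳ-* (+ (m C j)) (G j) ⟨
    ℤ.- (+ (m C j) ℤ.* G j)         ∎

prefixNegatives : (m : ℕ) → Cube (3 ℕ.+ m) → ℕ
prefixNegatives zero    _             = 0
prefixNegatives (suc m) (Sign.+ ∷ x) = prefixNegatives m x
prefixNegatives (suc m) (Sign.- ∷ x) = suc (prefixNegatives m x)

lastThree : (m : ℕ) → Cube (3 ℕ.+ m) → Cube 3
lastThree zero    x       = x
lastThree (suc m) (_ ∷ x) = lastThree m x

sumCube-byPrefixNegatives : ∀ m (F : ℕ → Cube 3 → ℤ) →
  sumCube (3 ℕ.+ m) (λ x → F (prefixNegatives m x) (lastThree m x)) ≡ binomialSum m (λ j → sumCube 3 (F j))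
sumCube-byPrefixNegatives zero    F = sym (trans (ZP.+-identityʳ _) (ZP.*-identityˡ _))
sumCube-byPrefixNegatives (suc m) F = begin
  sumCube (4 ℕ.+ m) (λ x → F (prefixNegatives (suc m) x) (lastThree (suc m) x))
    ≡⟨ sumCube-suc (3 ℕ.+ m) _ ⟩
  sumCube (3 ℕ.+ m) (λ x → F (prefixNegatives m x) (lastThree m x))
    ℤ.+ sumCube (3 ℕ.+ m) (λ x → F (suc (prefixNegatives m x)) (lastThree m x))
    ≡⟨ cong₂ ℤ._+_ (sumCube-byPrefixNegatives m F) (sumCube-byPrefixNegatives m (F ∘ suc)) ⟩
  binomialSum m (λ j → sumCube 3 (F j)) ℤ.+ binomialSum m (λ j → sumCube 3 (F (suc j)))
    ≡⟨ binomialSum-suc m (λ j → sumCube 3 (F j)) ⟩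
  binomialSum (suc m) (λ j → sumCube 3 (F j)) ∎
  where open ≡-Reasoning

profileSum : (m : ℕ) → (ℕ → Cube 3 → ℤ) → Subset (3 ℕ.+ m) → ℤ
profileSum m F S = sumCube (3 ℕ.+ m) (λ x → F (prefixNegatives m x) (lastThree m x) ℤ.* χ S x)

onLastThree : (m : ℕ) → Subset 3 → Subset (3 ℕ.+ m)
onLastThree zero    S = S
onLastThree (suc m) S = outside ∷ onLastThree m S

χ-onLastThree : ∀ m S (x : Cube (3 ℕ.+ m)) → χ (onLastThree m S) x ≡ χ S (lastThree m x)
χ-onLastThree zero    S x       = refl
χ-onLastThree (suc m) S (_ ∷ x) = χ-onLastThree m S x

profileSum-onLastThree : ∀ m F S →
  profileSum m F (onLastThree m S) ≡ binomialSum m (λ j → sumCube 3 (λ v → F j v ℤ.* χ S v))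
profileSum-onLastThree m F S = trans
  (sumCube-cong (3 ℕ.+ m) (λ x → cong (ℤ._*_ (F (prefixNegatives m x) (lastThree m x))) (χ-onLastThree m S x)))
  (sumCube-byPrefixNegatives m (λ j v → F j v ℤ.* χ S v))

χ-⊥ : ∀ {n} (x : Cube n) → χ ⊥ x ≡ + 1
χ-⊥ []      = refl
χ-⊥ (_ ∷ x) = χ-⊥ x

χ-⁅0⁆ : ∀ {n} s (x : Cube n) → χ ⁅ zero ⁆ (s ∷ x) ≡ ⟦ s ⟧
χ-⁅0⁆ s x = trans (cong (ℤ._*_ ⟦ s ⟧) (χ-⊥ x)) (ZP.*-identityʳ ⟦ s ⟧)

Δ : (ℕ → ℤ) → ℕ → ℤ
Δ T j = T j ℤ.- T (suc j)

profileSum-⁅0⁆ : ∀ m F → profileSum (suc m) F ⁅ zero ⁆ ≡ binomialSum m (Δ (λ j → sumCube 3 (F j)))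
profileSum-⁅0⁆ m F = begin
  profileSum (suc m) F ⁅ zero ⁆
    ≡⟨ sumCube-suc (3 ℕ.+ m) _ ⟩
  sumCube (3 ℕ.+ m) (λ x → F (j x) (v x) ℤ.* χ ⁅ zero ⁆ (Sign.+ ∷ x))
    ℤ.+ sumCube (3 ℕ.+ m) (λ x → F (suc (j x)) (v x) ℤ.* χ ⁅ zero ⁆ (Sign.- ∷ x))
    ≡⟨ cong₂ ℤ._+_ (sumCube-cong (3 ℕ.+ m) plus) (sumCube-cong (3 ℕ.+ m) minus) ⟩
  sumCube (3 ℕ.+ m) (λ x → F (j x) (v x)) ℤ.+ sumCube (3 ℕ.+ m) (λ x → ℤ.- F (suc (j x)) (v x))
    ≡⟨ cong₂ ℤ._+_ (sumCube-byPrefixNegatives m F) (sumCube-byPrefixNegatives m (λ i w → ℤ.- F (suc i) w)) ⟩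
  binomialSum m T ℤ.+ binomialSum m (λ i → sumCube 3 (λ w → ℤ.- F (suc i) w))
    ≡⟨ binomialSum-+ m T (λ i → sumCube 3 (λ w → ℤ.- F (suc i) w)) ⟩
  binomialSum m (λ i → T i ℤ.+ sumCube 3 (λ w → ℤ.- F (suc i) w))
    ≡⟨ binomialSum-cong m (λ i → cong (ℤ._+_ (T i)) (sumCube-neg 3 (F (suc i)))) ⟩
  binomialSum m (Δ T) ∎
  where
  open ≡-Reasoning
  j = prefixNegatives m
  v = lastThree m
  T : ℕ → ℤ
  T i = sumCube 3 (F i)
  plus : ∀ x → F (j x) (v x) ℤ.* χ ⁅ zero ⁆ (Sign.+ ∷ x) ≡ F (j x) (v x)
  plus x = trans (cong (ℤ._*_ (F (j x) (v x))) (χ-⁅0⁆ Sign.+ x)) (ZP.*-identityʳ _)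
  minus : ∀ x → F (suc (j x)) (v x) ℤ.* χ ⁅ zero ⁆ (Sign.- ∷ x) ≡ ℤ.- F (suc (j x)) (v x)
  minus x = trans (cong (ℤ._*_ (F (suc (j x)) (v x))) (χ-⁅0⁆ Sign.- x))
                  (trans (ZP.*-comm _ (ℤ.- + 1)) (ZP.-1*i≡-i _))

prefixSingletons : (m : ℕ) → List (Subset (3 ℕ.+ m))
prefixSingletons zero    = []
prefixSingletons (suc m) = ⁅ zero ⁆ ∷ map (outside ∷_) (prefixSingletons m)

profileSum-prefixSingletons : ∀ m F →
  All (λ S → profileSum (suc m) F S ≡ binomialSum m (Δ (λ j → sumCube 3 (F j)))) (prefixSingletons (suc m))
profileSum-prefixSingletons zero    F = profileSum-⁅0⁆ zero F ∷ []
profileSum-prefixSingletons (suc m) F = profileSum-⁅0⁆ (suc m) F ∷ AllP.map⁺ (All.zipWith shift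
  (profileSum-prefixSingletons m F , profileSum-prefixSingletons m (F ∘ suc)))
  where
  shift : ∀ {S} →
    profileSum (suc m) F S ≡ binomialSum m (Δ (λ j → sumCube 3 (F j))) ×
    profileSum (suc m) (F ∘ suc) S ≡ binomialSum m (Δ (λ j → sumCube 3 (F (suc j)))) →
    profileSum (suc (suc m)) F (outside ∷ S) ≡ binomialSum (suc m) (Δ (λ j → sumCube 3 (F j)))
  shift (eq , eq′) = trans (sumCube-suc (3 ℕ.+ suc m) _)
    (trans (cong₂ ℤ._+_ eq eq′) (binomialSum-suc m (Δ (λ j → sumCube 3 (F j)))))

positives negatives : ∀ {n} → Cube n → ℕ
positives = V.count (Sign._≟ Sign.+)
negatives = V.count (Sign._≟ Sign.-)

score : (m : ℕ) → Cube (3 ℕ.+ m) → ℤ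
score m x = V.foldr _ ℤ._+_ (+ 0) (zipWith (λ w s → w ℤ.* ⟦ s ⟧) (weightVec (3 ℕ.+ m)) x)

2+[2m+p]≡2[1+m]+p : ∀ m p → 2 ℕ.+ (2 ℕ.* m ℕ.+ p) ≡ 2 ℕ.* suc m ℕ.+ p
2+[2m+p]≡2[1+m]+p = ℕ-Solver.solve-∀

-- The first m coordinates carry weight 2, so with j of them negative they contribute 2m − 4j.
score≡counts : ∀ m x →
  score m x ≡ (2 ℕ.* m ℕ.+ positives (lastThree m x)) ⊖ (4 ℕ.* prefixNegatives m x ℕ.+ negatives (lastThree m x))
score≡counts zero (Sign.+ ∷ Sign.+ ∷ Sign.+ ∷ []) = refl
score≡counts zero (Sign.+ ∷ Sign.+ ∷ Sign.- ∷ []) = refl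
score≡counts zero (Sign.+ ∷ Sign.- ∷ Sign.+ ∷ []) = refl
score≡counts zero (Sign.+ ∷ Sign.- ∷ Sign.- ∷ []) = refl
score≡counts zero (Sign.- ∷ Sign.+ ∷ Sign.+ ∷ []) = refl
score≡counts zero (Sign.- ∷ Sign.+ ∷ Sign.- ∷ []) = refl
score≡counts zero (Sign.- ∷ Sign.- ∷ Sign.+ ∷ []) = refl
score≡counts zero (Sign.- ∷ Sign.- ∷ Sign.- ∷ []) = refl
score≡counts (suc m) (Sign.+ ∷ x) = begin
  + 2 ℤ.+ score m x      ≡⟨ cong (ℤ._+_ (+ 2)) (score≡counts m x) ⟩
  + 2 ℤ.+ (A ⊖ B)        ≡⟨ ZP.distribʳ-⊖-+-pos 2 A B ⟩
  (2 ℕ.+ A) ⊖ B          ≡⟨ cong (_⊖ B) (2+[2m+p]≡2[1+m]+p m p) ⟩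
  (2 ℕ.* suc m ℕ.+ p) ⊖ B ∎
  where
  open ≡-Reasoning
  p = positives (lastThree m x)
  A = 2 ℕ.* m ℕ.+ p
  B = 4 ℕ.* prefixNegatives m x ℕ.+ negatives (lastThree m x)
score≡counts (suc m) (Sign.- ∷ x) = begin
  -[1+ 1 ] ℤ.+ score m x          ≡⟨ cong (ℤ._+_ -[1+ 1 ]) (score≡counts m x) ⟩
  -[1+ 1 ] ℤ.+ (A ⊖ B)            ≡⟨ ZP.distribʳ-⊖-+-neg 1 A B ⟩
  A ⊖ (2 ℕ.+ B)                   ≡⟨ ZP.+-cancelˡ-⊖ 2 A (2 ℕ.+ B) ⟨
  (2 ℕ.+ A) ⊖ (2 ℕ.+ (2 ℕ.+ B))   ≡⟨ cong₂ _⊖_ (2+[2m+p]≡2[1+m]+p m p) (four-more j q) ⟩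
  (2 ℕ.* suc m ℕ.+ p) ⊖ (4 ℕ.* suc j ℕ.+ q) ∎
  where
  open ≡-Reasoning
  p = positives (lastThree m x)
  q = negatives (lastThree m x)
  j = prefixNegatives m x
  A = 2 ℕ.* m ℕ.+ p
  B = 4 ℕ.* j ℕ.+ q
  four-more : ∀ j q → 2 ℕ.+ (2 ℕ.+ (4 ℕ.* j ℕ.+ q)) ≡ 4 ℕ.* suc j ℕ.+ q
  four-more = ℕ-Solver.solve-∀

reducedG : ℕ → ℕ → Cube 3 → ℤ
reducedG m j v = ⟦ sgn ((2 ℕ.* m ℕ.+ positives v) ⊖ (4 ℕ.* j ℕ.+ negatives v)) ⟧

g≡reducedG : ∀ m x → ⟦ g (3 ℕ.+ m) x ⟧ ≡ reducedG m (prefixNegatives m x) (lastThree m x)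
g≡reducedG m x = cong (⟦_⟧ ∘ sgn) (score≡counts m x)

sgn-⊖-≥ : ∀ {m n} → n ≤ m → sgn (m ⊖ n) ≡ Sign.+
sgn-⊖-≥ n≤m rewrite ZP.⊖-≥ n≤m = refl

sgn-⊖-< : ∀ {m n} → m < n → sgn (m ⊖ n) ≡ Sign.-
sgn-⊖-< {m} {n} m<n = trans (sgn≡sign (m ⊖ n)) (ZP.sign-⊖-< m<n)
  where
  sgn≡sign : ∀ i → sgn i ≡ ℤ.sign i
  sgn≡sign (+ _)    = refl
  sgn≡sign -[1+ _ ] = refl

4*-absorbs-≤3 : ∀ {a b r} → a < b → r ≤ 3 → 4 ℕ.* a ℕ.+ r < 4 ℕ.* b
4*-absorbs-≤3 {a} {b} {r} a<b r≤3 = begin-strict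
  4 ℕ.* a ℕ.+ r   ≤⟨ NP.+-monoʳ-≤ (4 ℕ.* a) r≤3 ⟩
  4 ℕ.* a ℕ.+ 3   <⟨ NP.+-monoʳ-< (4 ℕ.* a) (NP.n<1+n 3) ⟩
  4 ℕ.* a ℕ.+ 4   ≡⟨ NP.+-comm (4 ℕ.* a) 4 ⟩
  4 ℕ.+ 4 ℕ.* a   ≡⟨ NP.*-suc 4 a ⟨
  4 ℕ.* suc a     ≤⟨ NP.*-monoʳ-≤ 4 a<b ⟩
  4 ℕ.* b         ∎
  where open NP.≤-Reasoning

2*[k+k]≡4*k : ∀ k → 2 ℕ.* (k ℕ.+ k) ≡ 4 ℕ.* k
2*[k+k]≡4*k = ℕ-Solver.solve-∀

positives≤3 : ∀ (v : Cube 3) → positives v ≤ 3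
positives≤3 = VP.count≤n (Sign._≟ Sign.+)

negatives≤3 : ∀ (v : Cube 3) → negatives v ≤ 3
negatives≤3 = VP.count≤n (Sign._≟ Sign.-)

reducedG-below : ∀ {k j} → j < k → ∀ v → reducedG (k ℕ.+ k) j v ≡ + 1
reducedG-below {k} {j} j<k v = cong ⟦_⟧ (sgn-⊖-≥ (begin
  4 ℕ.* j ℕ.+ negatives v            <⟨ 4*-absorbs-≤3 j<k (negatives≤3 v) ⟩
  4 ℕ.* k                            ≡⟨ 2*[k+k]≡4*k k ⟨
  2 ℕ.* (k ℕ.+ k)                    ≤⟨ NP.m≤m+n _ (positives v) ⟩
  2 ℕ.* (k ℕ.+ k) ℕ.+ positives v    ∎))
  where open NP.≤-Reasoning

reducedG-above : ∀ {k j} → k < j → ∀ v → reducedG (k ℕ.+ k) j v ≡ -[1+ 0 ]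
reducedG-above {k} {j} k<j v = cong ⟦_⟧ (sgn-⊖-< (begin-strict
  2 ℕ.* (k ℕ.+ k) ℕ.+ positives v    ≡⟨ cong (ℕ._+ positives v) (2*[k+k]≡4*k k) ⟩
  4 ℕ.* k ℕ.+ positives v            <⟨ 4*-absorbs-≤3 k<j (positives≤3 v) ⟩
  4 ℕ.* j                            ≤⟨ NP.m≤m+n _ (negatives v) ⟩
  4 ℕ.* j ℕ.+ negatives v            ∎))
  where open NP.≤-Reasoning

majority : Cube 3 → ℤ
majority v = ⟦ sgn (positives v ⊖ negatives v) ⟧

reducedG-at : ∀ k v → reducedG (k ℕ.+ k) k v ≡ majority v
reducedG-at k v = cong (⟦_⟧ ∘ sgn) (begin
  (2 ℕ.* (k ℕ.+ k) ℕ.+ positives v) ⊖ (4 ℕ.* k ℕ.+ negatives v)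
    ≡⟨ cong (λ a → (a ℕ.+ positives v) ⊖ (4 ℕ.* k ℕ.+ negatives v)) (2*[k+k]≡4*k k) ⟩
  (4 ℕ.* k ℕ.+ positives v) ⊖ (4 ℕ.* k ℕ.+ negatives v)
    ≡⟨ ZP.+-cancelˡ-⊖ (4 ℕ.* k) (positives v) (negatives v) ⟩
  positives v ⊖ negatives v ∎)
  where open ≡-Reasoning

suffixTotal : ℕ → ℕ → ℤ
suffixTotal k j = sumCube 3 (reducedG (k ℕ.+ k) j)

suffixTotal-below : ∀ {k j} → j < k → suffixTotal k j ≡ + 8
suffixTotal-below j<k = sumCube-cong 3 (reducedG-below j<k)

suffixTotal-at : ∀ k → suffixTotal k k ≡ + 0
suffixTotal-at k = sumCube-cong 3 (reducedG-at k)

suffixTotal-above : ∀ {k j} → k < j → suffixTotal k j ≡ ℤ.- + 8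
suffixTotal-above k<j = sumCube-cong 3 (reducedG-above k<j)

suffixTotal-antisym : ∀ k j → j ≤ k ℕ.+ k → suffixTotal k (k ℕ.+ k ∸ j) ≡ ℤ.- suffixTotal k j
suffixTotal-antisym k j j≤2k with NP.<-cmp j k
... | tri< j<k _ _ = trans (suffixTotal-above k<2k∸j) (cong ℤ.-_ (sym (suffixTotal-below j<k)))
  where
  k<2k∸j : k < k ℕ.+ k ∸ j
  k<2k∸j = subst (k <_) (sym (NP.+-∸-assoc k (NP.<⇒≤ j<k))) (NP.m<m+n k (NP.m<n⇒0<n∸m j<k))
... | tri≈ _ refl _ = begin
  suffixTotal k (k ℕ.+ k ∸ k)   ≡⟨ cong (suffixTotal k) (NP.m+n∸n≡m k k) ⟩
  suffixTotal k k               ≡⟨ suffixTotal-at k ⟩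
  + 0                           ≡⟨ cong ℤ.-_ (suffixTotal-at k) ⟨
  ℤ.- suffixTotal k k           ∎
  where open ≡-Reasoning
... | tri> _ _ k<j = trans (suffixTotal-below 2k∸j<k) (cong ℤ.-_ (sym (suffixTotal-above k<j)))
  where
  2k∸j<k : k ℕ.+ k ∸ j < k
  2k∸j<k = subst (k ℕ.+ k ∸ j <_) (NP.m+n∸n≡m k k) (NP.∸-monoʳ-< k<j j≤2k)

coefficient : (n : ℕ) → Subset n → ℤ
coefficient n S = sumCube n (λ x → ⟦ g n x ⟧ ℤ.* χ S x)

coefficient≡profileSum : ∀ m S → coefficient (3 ℕ.+ m) S ≡ profileSum m (reducedG m) S
coefficient≡profileSum m S = sumCube-cong (3 ℕ.+ m) (λ x → cong (ℤ._* χ S x) (g≡reducedG m x))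

coefficient-⊥ : ∀ k → coefficient (3 ℕ.+ (k ℕ.+ k)) ⊥ ≡ + 0
coefficient-⊥ k = begin
  coefficient (3 ℕ.+ m) ⊥
    ≡⟨ coefficient≡profileSum m ⊥ ⟩
  profileSum m (reducedG m) ⊥
    ≡⟨ sumCube-cong (3 ℕ.+ m) (λ x → trans (cong (ℤ._*_ (reducedG m (prefixNegatives m x) (lastThree m x))) (χ-⊥ x)) (ZP.*-identityʳ _)) ⟩
  sumCube (3 ℕ.+ m) (λ x → reducedG m (prefixNegatives m x) (lastThree m x))
    ≡⟨ sumCube-byPrefixNegatives m (reducedG m) ⟩
  binomialSum m (suffixTotal k)
    ≡⟨ binomialSum-antisym m (suffixTotal k) (suffixTotal-antisym k) ⟩
  + 0 ∎
  where
  open ≡-Reasoning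
  m = k ℕ.+ k

coefficient-onLastThree : ∀ k S → sumCube 3 (χ S) ≡ + 0 → sumCube 3 (λ v → majority v ℤ.* χ S v) ≡ + 4 →
  coefficient (3 ℕ.+ (k ℕ.+ k)) (onLastThree (k ℕ.+ k) S) ≡ + (2 ℕ.* (2 ℕ.* ((k ℕ.+ k) C k)))
coefficient-onLastThree k S balanced correlation = begin
  coefficient (3 ℕ.+ m) (onLastThree m S)
    ≡⟨ coefficient≡profileSum m (onLastThree m S) ⟩
  profileSum m (reducedG m) (onLastThree m S)
    ≡⟨ profileSum-onLastThree m (reducedG m) S ⟩
  binomialSum m E
    ≡⟨ sumBelow-window k 1 (λ j → + (m C j) ℤ.* E j) (s≤s (NP.m≤m+n k k)) below above ⟩
  + c ℤ.* E k ℤ.+ + 0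
    ≡⟨ cong (λ e → + c ℤ.* e ℤ.+ + 0) (trans (sumCube-cong 3 (λ v → cong (ℤ._* χ S v) (reducedG-at k v))) correlation) ⟩
  + c ℤ.* + 4 ℤ.+ + 0
    ≡⟨ trans (ZP.+-identityʳ _) (sym (ZP.pos-* c 4)) ⟩
  + (c ℕ.* 4)
    ≡⟨ cong +_ (four c) ⟩
  + (2 ℕ.* (2 ℕ.* c)) ∎
  where
  open ≡-Reasoning
  m = k ℕ.+ k
  c = m C k
  E : ℕ → ℤ
  E j = sumCube 3 (λ v → reducedG m j v ℤ.* χ S v)
  constant : ∀ j a → (∀ v → reducedG m j v ≡ a) → + (m C j) ℤ.* E j ≡ + 0
  constant j a const = trans (cong (ℤ._*_ (+ (m C j))) (begin
    E j                              ≡⟨ sumCube-cong 3 (λ v → cong (ℤ._* χ S v) (const v)) ⟩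
    sumCube 3 (λ v → a ℤ.* χ S v)    ≡⟨ sumCube-*ˡ 3 a (χ S) ⟩
    a ℤ.* sumCube 3 (χ S)            ≡⟨ cong (ℤ._*_ a) balanced ⟩
    a ℤ.* + 0                        ≡⟨ ZP.*-zeroʳ a ⟩
    + 0                              ∎)) (ZP.*-zeroʳ (+ (m C j)))
  below : ∀ j → j < k → + (m C j) ℤ.* E j ≡ + 0
  below j j<k = constant j (+ 1) (reducedG-below j<k)
  above : ∀ j → 1 ℕ.+ k ≤ j → + (m C j) ℤ.* E j ≡ + 0
  above j k<j = constant j -[1+ 0 ] (reducedG-above k<j)
  four : ∀ c → c ℕ.* 4 ≡ 2 ℕ.* (2 ℕ.* c)
  four = ℕ-Solver.solve-∀

coefficient-prefix : ∀ k →
  All (λ S → coefficient (3 ℕ.+ (suc k ℕ.+ suc k)) S ≡ + (2 ℕ.* (8 ℕ.* ((k ℕ.+ suc k) C k))))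
      (prefixSingletons (suc k ℕ.+ suc k))
coefficient-prefix k =
  All.map (λ {S} eq → trans (coefficient≡profileSum m S) (trans eq value)) (profileSum-prefixSingletons m′ (reducedG m))
  where
  m′ = k ℕ.+ suc k
  m = suc m′
  c = m′ C k
  D = Δ (suffixTotal (suc k))
  D-k : D k ≡ + 8
  D-k = cong₂ ℤ._-_ (suffixTotal-below (NP.n<1+n k)) (suffixTotal-at (suc k))
  D-1+k : D (suc k) ≡ + 8
  D-1+k = cong₂ ℤ._-_ (suffixTotal-at (suc k)) (suffixTotal-above (NP.n<1+n (suc k)))
  below : ∀ j → j < k → + (m′ C j) ℤ.* D j ≡ + 0
  below j j<k = trans (cong (ℤ._*_ (+ (m′ C j)))
    (cong₂ ℤ._-_ (suffixTotal-below (NP.m<n⇒m<1+n j<k)) (suffixTotal-below (s≤s j<k)))) (ZP.*-zeroʳ (+ (m′ C j)))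
  above : ∀ j → 2 ℕ.+ k ≤ j → + (m′ C j) ℤ.* D j ≡ + 0
  above j 1+k<j = trans (cong (ℤ._*_ (+ (m′ C j)))
    (cong₂ ℤ._-_ (suffixTotal-above 1+k<j) (suffixTotal-above (NP.m<n⇒m<1+n 1+k<j)))) (ZP.*-zeroʳ (+ (m′ C j)))
  symmetric : m′ C suc k ≡ c
  symmetric = trans (nCk≡nC[n∸k] (NP.m≤n+m (suc k) k)) (cong (m′ C_) (NP.m+n∸n≡m k (suc k)))
  sixteen : ∀ c → c ℕ.* 8 ℕ.+ (c ℕ.* 8 ℕ.+ 0) ≡ 2 ℕ.* (8 ℕ.* c)
  sixteen = ℕ-Solver.solve-∀
  value : binomialSum m′ D ≡ + (2 ℕ.* (8 ℕ.* c))
  value = begin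
    binomialSum m′ D
      ≡⟨ sumBelow-window k 2 (λ j → + (m′ C j) ℤ.* D j) (s≤s (NP.m≤n+m (suc k) k)) below above ⟩
    + c ℤ.* D k ℤ.+ (+ (m′ C suc k) ℤ.* D (suc k) ℤ.+ + 0)
      ≡⟨ cong₂ (λ a b → + c ℤ.* a ℤ.+ (+ b ℤ.* D (suc k) ℤ.+ + 0)) D-k symmetric ⟩
    + c ℤ.* + 8 ℤ.+ (+ c ℤ.* D (suc k) ℤ.+ + 0)
      ≡⟨ cong (λ b → + c ℤ.* + 8 ℤ.+ (+ c ℤ.* b ℤ.+ + 0)) D-1+k ⟩
    + c ℤ.* + 8 ℤ.+ (+ c ℤ.* + 8 ℤ.+ + 0)
      ≡⟨ cong₂ (λ a b → a ℤ.+ (b ℤ.+ + 0)) (ZP.pos-* c 8) (ZP.pos-* c 8) ⟨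
    + (c ℕ.* 8 ℕ.+ (c ℕ.* 8 ℕ.+ 0))
      ≡⟨ cong +_ (sixteen c) ⟩
    + (2 ℕ.* (8 ℕ.* c)) ∎
    where open ≡-Reasoning

filterᵇ-map : ∀ {A B : Set} (p : B → Bool) (f : A → B) xs → filterᵇ p (map f xs) ≡ map f (filterᵇ (p ∘ f) xs)
filterᵇ-map p f []       = refl
filterᵇ-map p f (x ∷ xs) with p (f x)
... | true  = cong (f x ∷_) (filterᵇ-map p f xs)
... | false = filterᵇ-map p f xs

filterᵇ-false : ∀ {A : Set} (xs : List A) → filterᵇ (λ _ → false) xs ≡ []
filterᵇ-false []       = refl
filterᵇ-false (_ ∷ xs) = filterᵇ-false xs

filterᵇ-allSubsets-suc : ∀ (p : ∀ {n} → Subset n → Bool) n →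
  filterᵇ p (allSubsets (suc n)) ≡
    map (inside ∷_) (filterᵇ (p ∘ (inside ∷_)) (allSubsets n)) ++ map (outside ∷_) (filterᵇ (p ∘ (outside ∷_)) (allSubsets n))
filterᵇ-allSubsets-suc p n = begin
  filterᵇ p (map (inside ∷_) Ss ++ (map (outside ∷_) Ss ++ []))
    ≡⟨ cong (λ ys → filterᵇ p (map (inside ∷_) Ss ++ ys)) (LP.++-identityʳ _) ⟩
  filterᵇ p (map (inside ∷_) Ss ++ map (outside ∷_) Ss)
    ≡⟨ LP.filter-++ (T? ∘ p) (map (inside ∷_) Ss) (map (outside ∷_) Ss) ⟩
  filterᵇ p (map (inside ∷_) Ss) ++ filterᵇ p (map (outside ∷_) Ss)
    ≡⟨ cong₂ _++_ (filterᵇ-map p (inside ∷_) Ss) (filterᵇ-map p (outside ∷_) Ss) ⟩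
  map (inside ∷_) (filterᵇ (p ∘ (inside ∷_)) Ss) ++ map (outside ∷_) (filterᵇ (p ∘ (outside ∷_)) Ss) ∎
  where
  open ≡-Reasoning
  Ss = allSubsets n

hasSize : ℕ → ∀ {n} → Subset n → Bool
hasSize k S = ∣ S ∣ ℕ.≡ᵇ k

-- hasSize (suc k) ∘ (inside ∷_) reduces to hasSize k, and hasSize 0 ∘ (inside ∷_) to λ _ → false.
subsets-of-size-0 : ∀ n → filterᵇ (hasSize 0) (allSubsets n) ≡ ⊥ ∷ []
subsets-of-size-0 zero    = refl
subsets-of-size-0 (suc n) = trans (filterᵇ-allSubsets-suc (hasSize 0) n)
  (cong₂ (λ xs ys → map (inside ∷_) xs ++ map (outside ∷_) ys) (filterᵇ-false (allSubsets n)) (subsets-of-size-0 n))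

singletons : (n : ℕ) → List (Subset n)
singletons zero    = []
singletons (suc n) = ⁅ zero ⁆ ∷ map (outside ∷_) (singletons n)

subsets-of-size-1 : ∀ n → filterᵇ (hasSize 1) (allSubsets n) ≡ singletons n
subsets-of-size-1 zero    = refl
subsets-of-size-1 (suc n) = trans (filterᵇ-allSubsets-suc (hasSize 1) n)
  (cong₂ (λ xs ys → map (inside ∷_) xs ++ map (outside ∷_) ys) (subsets-of-size-0 n) (subsets-of-size-1 n))

singletons-3+ : ∀ m → singletons (3 ℕ.+ m) ≡ prefixSingletons m ++ map (onLastThree m) (singletons 3)
singletons-3+ zero    = refl
singletons-3+ (suc m) = cong (⁅ zero ⁆ ∷_) (trans (cong (map (outside ∷_)) (singletons-3+ m))
  (LP.map-++ (outside ∷_) (prefixSingletons m) (map (onLastThree m) (singletons 3))))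

length-prefixSingletons : ∀ m → length (prefixSingletons m) ≡ m
length-prefixSingletons zero    = refl
length-prefixSingletons (suc m) = cong suc (trans (LP.length-map _ (prefixSingletons m)) (length-prefixSingletons m))

sumℚ-++ : ∀ xs ys → sumℚ (xs ++ ys) ≡ sumℚ xs + sumℚ ys
sumℚ-++ []       ys = sym (QP.+-identityˡ _)
sumℚ-++ (x ∷ xs) ys = trans (cong (_+_ x) (sumℚ-++ xs ys)) (sym (QP.+-assoc x _ _))

+[1+n]/1≡1+n/1 : ∀ n → + suc n ℚ./ 1 ≡ 1ℚ + + n ℚ./ 1
+[1+n]/1≡1+n/1 n = begin
  + suc n ℚ./ 1                     ≡⟨ QP./-cong (cong (ℤ._+_ (+ 1)) (sym (ZP.*-identityʳ (+ n)))) refl ⟩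
  (+ 1 ℤ.+ + n ℤ.* + 1) ℚ./ 1       ≡⟨⟩
  1ℚ + mkℚ (+ n) 0 n/1-coprime      ≡⟨ cong (_+_ 1ℚ) (QP.↥p/↧p≡p (mkℚ (+ n) 0 n/1-coprime)) ⟨
  1ℚ + + n ℚ./ 1                    ∎
  where
  open ≡-Reasoning
  n/1-coprime = Coprimality.sym (Coprimality.1-coprimeTo n)

sumℚ-map-const : ∀ {A : Set} {h : A → ℚ} {q xs} → All (λ a → h a ≡ q) xs →
                 sumℚ (map h xs) ≡ + length xs ℚ./ 1 * q
sumℚ-map-const {q = q} []                   = sym (QP.*-zeroˡ q)
sumℚ-map-const {h = h} {q = q} (_∷_ {x = x} {xs = xs} hx≡q hxs≡q) = begin
  h x + sumℚ (map h xs)                ≡⟨ cong₂ _+_ hx≡q (sumℚ-map-const hxs≡q) ⟩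
  q + + length xs ℚ./ 1 * q          ≡⟨ cong (_+ + length xs ℚ./ 1 * q) (QP.*-identityˡ q) ⟨
  1ℚ * q + + length xs ℚ./ 1 * q     ≡⟨ QP.*-distribʳ-+ q 1ℚ (+ length xs ℚ./ 1) ⟨
  (1ℚ + + length xs ℚ./ 1) * q       ≡⟨ cong (_* q) (+[1+n]/1≡1+n/1 (length xs)) ⟨
  + suc (length xs) ℚ./ 1 * q        ∎
  where open ≡-Reasoning

*≡*⇒/≡ : ∀ (p q : ℤ) (b d : ℕ) .{{_ : NonZero b}} .{{_ : NonZero d}} →
          p ℤ.* + d ≡ q ℤ.* + b → p ℚ./ b ≡ q ℚ./ d
*≡*⇒/≡ p q (suc b) (suc d) eq = QP.fromℚᵘ-cong {mkℚᵘ p b} {mkℚᵘ q d} (*≡* eq)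

+[2*a]/2^[1+x]≡+a/2^x : ∀ a x →
  ℚ._/_ (+ (2 ℕ.* a)) (2 ^ suc x) {{m^n≢0 2 (suc x)}} ≡ ℚ._/_ (+ a) (2 ^ x) {{m^n≢0 2 x}}
+[2*a]/2^[1+x]≡+a/2^x a x = *≡*⇒/≡ (+ (2 ℕ.* a)) (+ a) (2 ^ suc x) (2 ^ x) {{m^n≢0 2 (suc x)}} {{m^n≢0 2 x}} (begin
  + (2 ℕ.* a) ℤ.* + 2 ^ x       ≡⟨ ZP.pos-* (2 ℕ.* a) (2 ^ x) ⟨
  + (2 ℕ.* a ℕ.* 2 ^ x)         ≡⟨ cong +_ (swap-2 a (2 ^ x)) ⟩
  + (a ℕ.* (2 ℕ.* 2 ^ x))       ≡⟨ ZP.pos-* a (2 ℕ.* 2 ^ x) ⟩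
  + a ℤ.* + (2 ℕ.* 2 ^ x)       ∎)
  where
  open ≡-Reasoning
  swap-2 : ∀ a b → 2 ℕ.* a ℕ.* b ≡ a ℕ.* (2 ℕ.* b)
  swap-2 = ℕ-Solver.solve-∀

fourier≡ : ∀ x S a → coefficient (suc x) S ≡ + (2 ℕ.* a) →
           fourier (g (suc x)) S ≡ ℚ._/_ (+ a) (2 ^ x) {{m^n≢0 2 x}}
fourier≡ x S a eq =
  trans (cong (λ i → ℚ._/_ i (2 ^ suc x) {{m^n≢0 2 (suc x)}}) eq) (+[2*a]/2^[1+x]≡+a/2^x a x)

[k+k]/2≡k : ∀ k → (k ℕ.+ k) / 2 ≡ k
[k+k]/2≡k k = trans (cong (_/ 2) (double k)) (DM.m*n/n≡m k 2)
  where
  double : ∀ k → k ℕ.+ k ≡ k ℕ.* 2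
  double = ℕ-Solver.solve-∀

prefixWeight suffixWeight : ℕ → ℚ
prefixWeight n = ℚ._/_ (+ (8 ℕ.* ((n ∸ 4) C ((n ∸ 5) / 2)))) (2 ^ (n ∸ 1)) {{m^n≢0 2 (n ∸ 1)}}
suffixWeight n = ℚ._/_ (+ (2 ℕ.* ((n ∸ 3) C ((n ∸ 3) / 2)))) (2 ^ (n ∸ 1)) {{m^n≢0 2 (n ∸ 1)}}

fourier-prefixSingletons : ∀ k →
  All (λ S → fourier (g (3 ℕ.+ (k ℕ.+ k))) S ≡ prefixWeight (3 ℕ.+ (k ℕ.+ k))) (prefixSingletons (k ℕ.+ k))
fourier-prefixSingletons zero    = []
fourier-prefixSingletons (suc k) = All.map (λ {S} eq →
    trans (fourier≡ (3 ℕ.+ m′) S (8 ℕ.* (m′ C k)) eq) (cong (λ i → ℚ._/_ (+ (8 ℕ.* (m′ C i))) (2 ^ (3 ℕ.+ m′)) {{m^n≢0 2 (3 ℕ.+ m′)}}) (sym half)))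
  (coefficient-prefix k)
  where
  m′ = k ℕ.+ suc k
  half : (m′ ∸ 1) / 2 ≡ k
  half = trans (cong (λ i → (i ∸ 1) / 2) (NP.+-suc k k)) ([k+k]/2≡k k)

fourier-lastThree : ∀ k →
  All (λ S → fourier (g (3 ℕ.+ (k ℕ.+ k))) S ≡ suffixWeight (3 ℕ.+ (k ℕ.+ k))) (map (onLastThree (k ℕ.+ k)) (singletons 3))
fourier-lastThree k = AllP.map⁺ {f = onLastThree (k ℕ.+ k)} (at refl refl ∷ at refl refl ∷ at refl refl ∷ [])
  where
  m = k ℕ.+ k
  at : ∀ {S} → sumCube 3 (χ S) ≡ + 0 → sumCube 3 (λ v → majority v ℤ.* χ S v) ≡ + 4 →
       fourier (g (3 ℕ.+ m)) (onLastThree m S) ≡ suffixWeight (3 ℕ.+ m)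
  at {S} balanced correlation = trans (fourier≡ (2 ℕ.+ m) (onLastThree m S) (2 ℕ.* (m C k)) (coefficient-onLastThree k S balanced correlation))
    (cong (λ i → ℚ._/_ (+ (2 ℕ.* (m C i))) (2 ^ (2 ℕ.+ m)) {{m^n≢0 2 (2 ℕ.+ m)}}) (sym ([k+k]/2≡k k)))

-- W⁰-g and W¹-g take the equation m ≡ k + k as an argument: a with-abstraction over it in lemma3
-- would normalise the goal, whose rational arithmetic does not evaluate in reasonable time.
W⁰-g : ∀ {m} k → m ≡ k ℕ.+ k → W 0 (g (3 ℕ.+ m)) ≡ 0ℚ
W⁰-g k refl = begin
  W 0 (g n)                            ≡⟨ cong (sumℚ ∘ map (λ S → f̂ S * f̂ S)) (subsets-of-size-0 n) ⟩
  f̂ ⊥ * f̂ ⊥ + 0ℚ                       ≡⟨ cong (λ q → q * q + 0ℚ) f̂⊥≡0 ⟩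
  0ℚ                                   ∎
  where
  open ≡-Reasoning
  n = 3 ℕ.+ (k ℕ.+ k)
  f̂ = fourier (g n)
  f̂⊥≡0 : f̂ ⊥ ≡ 0ℚ
  f̂⊥≡0 = trans (cong (λ i → ℚ._/_ i (2 ^ n) {{m^n≢0 2 n}}) (coefficient-⊥ k)) (QP.0/n≡0 (2 ^ n) {{m^n≢0 2 n}})

W¹-g : ∀ {m} k → m ≡ k ℕ.+ k → let n = 3 ℕ.+ m in
  W 1 (g n) ≡ + (n ∸ 3) ℚ./ 1 * (prefixWeight n * prefixWeight n) + + 3 ℚ./ 1 * (suffixWeight n * suffixWeight n)
W¹-g k refl = begin
  W 1 (g n)
    ≡⟨ cong (sumℚ ∘ map sq) (trans (subsets-of-size-1 n) (singletons-3+ m)) ⟩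
  sumℚ (map sq (prefixSingletons m ++ lastThrees))
    ≡⟨ cong sumℚ (LP.map-++ sq (prefixSingletons m) lastThrees) ⟩
  sumℚ (map sq (prefixSingletons m) ++ map sq lastThrees)
    ≡⟨ sumℚ-++ (map sq (prefixSingletons m)) (map sq lastThrees) ⟩
  sumℚ (map sq (prefixSingletons m)) + sumℚ (map sq lastThrees)
    ≡⟨ cong₂ _+_ (sumℚ-map-const (All.map (λ eq → cong₂ _*_ eq eq) (fourier-prefixSingletons k)))
                 (sumℚ-map-const (All.map (λ eq → cong₂ _*_ eq eq) (fourier-lastThree k))) ⟩
  + length (prefixSingletons m) ℚ./ 1 * (A * A) + + 3 ℚ./ 1 * (B * B)
    ≡⟨ cong (λ l → + l ℚ./ 1 * (A * A) + + 3 ℚ./ 1 * (B * B)) (length-prefixSingletons m) ⟩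
  + m ℚ./ 1 * (A * A) + + 3 ℚ./ 1 * (B * B) ∎
  where
  open ≡-Reasoning
  m = k ℕ.+ k
  n = 3 ℕ.+ m
  A = prefixWeight n
  B = suffixWeight n
  lastThrees = map (onLastThree m) (singletons 3)
  sq : Subset n → ℚ
  sq S = fourier (g n) S * fourier (g n) S

[3+m]%2≡1⇒m≡k+k : ∀ m → (3 ℕ.+ m) % 2 ≡ 1 → ∃[ k ] m ≡ k ℕ.+ k
[3+m]%2≡1⇒m≡k+k zero          _   = 0 , refl
[3+m]%2≡1⇒m≡k+k (suc zero)    ()
-- odd : (5 + m) % 2 ≡ 1, which reduces to (3 + m) % 2 ≡ 1.
[3+m]%2≡1⇒m≡k+k (suc (suc m)) odd with [3+m]%2≡1⇒m≡k+k m odd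
... | k , refl = suc k , cong suc (sym (NP.+-suc k k))

lemma3 : (n : ℕ) → 3 ≤ n → n % 2 ≡ 1 →
  (W 0 (g n) ≡ 0ℚ) ×
  (W 1 (g n) ≡
     (ℚ._/_ (+ (n ∸ 3)) 1)
       * (ℚ._/_ (+ (8 ℕ.* ((n ∸ 4) C ((n ∸ 5) / 2)))) (2 ^ (n ∸ 1)) {{m^n≢0 2 (n ∸ 1)}}
          * ℚ._/_ (+ (8 ℕ.* ((n ∸ 4) C ((n ∸ 5) / 2)))) (2 ^ (n ∸ 1)) {{m^n≢0 2 (n ∸ 1)}})
     + ℚ._/_ (+ 3) 1
       * (ℚ._/_ (+ (2 ℕ.* ((n ∸ 3) C ((n ∸ 3) / 2)))) (2 ^ (n ∸ 1)) {{m^n≢0 2 (n ∸ 1)}}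
          * ℚ._/_ (+ (2 ℕ.* ((n ∸ 3) C ((n ∸ 3) / 2)))) (2 ^ (n ∸ 1)) {{m^n≢0 2 (n ∸ 1)}}))
lemma3 (suc (suc (suc m))) (s≤s (s≤s (s≤s z≤n))) odd =
  let k , m≡k+k = [3+m]%2≡1⇒m≡k+k m odd in W⁰-g k m≡k+k , W¹-g k m≡k+k
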